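{- For all positive integers $c$ and $d$, $V(c,d) > c^{2^d-1}/(e\,2^d)$, where $e=2.718\ldots$ is the base of the natural logarithm. In particular $V(c,d)=\Omega(c^{2^d-1})$, where the implied constant depends only on $d$.
   Context: For positive integers $a_1,\ldots,a_d$, the $d$-dimensional grid $[a_1,\ldots,a_d]$ is the set $[a_1]\times\cdots\times[a_d]$ with $[t]=\{1,\ldots,t\}$; its volume is $\prod_i a_i$. A $d$-dimensional box in a grid $R$ is a subset of $R$ of the form $\{b_1,c_1\}\times\cdots\times\{b_d,c_d\}$ with $b_i\neq c_i$ for all $i$ (a set of $2^d$ points). A grid $R$ is $c$-guaranteed if every coloring $f:R\to[c]$ has a monochromatic box (a box $B$ with $|f(B)|=1$); otherwise $R$ is $c$-colorable. $V(c,d)$ denotes the largest integer $V$ such that every $d$-dimensional grid of volume at most $V$ is $c$-colorable. -}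

module Defs where

open import Data.Nat using (ℕ; zero; suc; _+_; _*_; _≤_)
open import Data.Fin using (Fin)
import Data.Fin as F
open import Data.Bool using (Bool; true; false)
open import Data.Product using (Σ; ∃; _×_; _,_)
open import Relation.Nullary using (¬_)
open import Relation.Binary.PropositionalEquality using (_≡_)

volume : ∀ {d} → (Fin d → ℕ) → ℕ
volume {zero}  a = 1
volume {suc d} a = a F.zero * volume (λ i → a (F.suc i))

Positive : ∀ {d} → (Fin d → ℕ) → Set
Positive {d} a = (i : Fin d) → 1 ≤ a i

-- Points of the grid [a_1] × ... × [a_d]  (coordinate i ranges over Fin (a i),
-- i.e. [a_i] shifted to start at 0).
Point : ∀ {d} → (Fin d → ℕ) → Set
Point {d} a = (i : Fin d) → Fin (a i)

Coloring : ℕ → ∀ {d} → (Fin d → ℕ) → Set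
Coloring c a = Point a → Fin c

record Box {d} (a : Fin d → ℕ) : Set where
  constructor box
  field
    lo   : Point a
    hi   : Point a
    dist : (i : Fin d) → ¬ (lo i ≡ hi i)

boxPoint : ∀ {d} {a : Fin d → ℕ} → Box a → (Fin d → Bool) → Point a
boxPoint B s i with s i
... | true  = Box.hi B i
... | false = Box.lo B i

Monochromatic : ∀ {c d} {a : Fin d → ℕ} → Coloring c a → Box a → Set
Monochromatic {c} f B = Σ (Fin c) λ k → (s : _) → f (boxPoint B s) ≡ k

Guaranteed : (c : ℕ) → ∀ {d} → (Fin d → ℕ) → Set
Guaranteed c a = (f : Coloring c a) → Σ (Box a) λ B → Monochromatic f B

Colorable : (c : ℕ) → ∀ {d} → (Fin d → ℕ) → Set
Colorable c a = ¬ Guaranteed c a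

AllColorableUpTo : (c d V : ℕ) → Set
AllColorableUpTo c d V =
  (a : Fin d → ℕ) → Positive a → volume a ≤ V → Colorable c a

IsV : (c d V : ℕ) → Set
IsV c d V = AllColorableUpTo c d V × ((W : ℕ) → AllColorableUpTo c d W → W ≤ V)

fact : ℕ → ℕ
fact zero    = 1
fact (suc n) = suc n * fact n

-- eNum n = n! * (Σ_{k=0}^{n} 1/k!)  =  Σ_{k=0}^{n} n!/k!,
-- so eNum n / n! is the n-th partial sum of e = Σ_k 1/k!.
-- Recurrence: eNum 0 = 1, eNum (n+1) = (n+1) * eNum n + 1.
eNum : ℕ → ℕ
eNum zero    = 1
eNum (suc n) = suc n * eNum n + 1

-- Colour a grid of volume at most V + 1 uniformly at random with c colours. The event that a
-- box is monochromatic has probability c^(1 - 2^d) and is determined by the colours of its 2^d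
-- points; a point lies in ∏ (a_i - 1) ≤ V boxes, so each box shares points with at most
-- D = 2^d V - 1 other boxes. The symmetric Lovász local lemma, proved here in counting form on
-- finite product spaces (among the colourings avoiding any set of events not containing e, the
-- event e takes a share of at most 1/(D+1)), gives a colouring without monochromatic boxes as
-- soon as c^(2^d - 1) ≥ (D+1)^(D+1) / D^D. For V = V(c,d) this must fail, so
-- c^(2^d - 1) < (D+1) (1 + 1/D)^D ≤ 2^d V · eNum D / D!, by (1 + 1/D)^D ≤ Σ_{k ≤ D} 1/k!.

module Submission where

open import Defs
open import Data.Nat using (ℕ; suc; _*_; _^_; _∸_; _<_; _≤_)
open import Data.Product using (∃)
open import Data.Nat.Base hiding (_<ᵇ_)
open import Data.Nat.Properties hiding (_≟_; _<?_; <-cmp; <-irrefl; <-asym)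
open import Data.Nat.Tactic.RingSolver using (solve-∀)
open import Data.Fin using (Fin; zero; suc; _↑ˡ_; _↑ʳ_; combine; remQuot)
open import Data.Fin.Properties using (_≟_; _<?_; <-cmp; <-irrefl; <-asym; remQuot-combine; combine-remQuot)
open import Data.Bool using (Bool; true; false; _∧_; _∨_; not; if_then_else_)
open import Data.Bool.Properties
  using (∧-identityʳ; ∧-zeroʳ; ∧-conicalˡ; ∧-conicalʳ; ∧-distribʳ-∨; ∨-identityʳ; ∨-zeroʳ; ∨-comm; not-involutive;
         ∧-commutativeMonoid; ∨-∧-booleanAlgebra)
open import Algebra.Lattice.Properties.BooleanAlgebra ∨-∧-booleanAlgebra using (deMorgan₂)
open import Data.Product using (_×_; _,_; proj₁; proj₂)
open import Function using (_∘_)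
open import Algebra.Bundles using (CommutativeMonoid)
open import Relation.Nullary using (Dec; yes; no; contradiction)
open import Relation.Nullary.Decidable using (does; dec-true; dec-false)
open import Relation.Binary.Definitions using (tri<; tri≈; tri>)
open import Relation.Binary.PropositionalEquality
open import Algebra.Properties.CommutativeSemigroup *-commutativeSemigroup
  using (x∙yz≈y∙xz; x∙yz≈yx∙z; x∙yz≈zy∙x; xy∙z≈y∙xz)
open import Algebra.Properties.CommutativeSemigroup (CommutativeMonoid.commutativeSemigroup ∧-commutativeMonoid)
  using () renaming (interchange to ∧-interchange)
open import Algebra.Properties.Semiring.Sum +-*-semiring
  using (sum; sum-syntax; sum-cong-≗; ∑-distrib-+; ∑-comm; *-distribˡ-sum; *-distribʳ-sum)

-- Finite sums, Boolean predicates and subsets of Fin n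

infix 4 _==_
-- does rather than ⌊_⌋, so that suc i == suc j reduces to i == j.
_==_ : ∀ {n} → Fin n → Fin n → Bool
i == j = does (i ≟ j)

==-comm : ∀ {n} (i j : Fin n) → (i == j) ≡ (j == i)
==-comm i j with i ≟ j | j ≟ i
... | yes _   | yes _   = refl
... | no  _   | no  _   = refl
... | yes i≡j | no  j≢i = contradiction (sym i≡j) j≢i
... | no  i≢j | yes j≡i = contradiction (sym j≡i) i≢j

indicator : Bool → ℕ
indicator true  = 1
indicator false = 0

indicator-∧ : ∀ a b → indicator (a ∧ b) ≡ indicator a * indicator b
indicator-∧ true  b = sym (+-identityʳ (indicator b))
indicator-∧ false b = refl

indicator-split : ∀ a b → indicator a ≡ indicator (a ∧ b) + indicator (a ∧ not b)
indicator-split true  true  = refl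
indicator-split true  false = refl
indicator-split false b     = refl

indicator-mono : ∀ {a b} → (a ≡ true → b ≡ true) → indicator a ≤ indicator b
indicator-mono {false} _ = z≤n
indicator-mono {true}  h rewrite h refl = ≤-refl

∑-mono : ∀ {n} {f g : Fin n → ℕ} → (∀ i → f i ≤ g i) → sum f ≤ sum g
∑-mono {zero}  h = z≤n
∑-mono {suc n} h = +-mono-≤ (h zero) (∑-mono (h ∘ suc))

∑-const : ∀ n x → ∑[ i < n ] x ≡ n * x
∑-const zero    x = refl
∑-const (suc n) x = cong (x +_) (∑-const n x)

∑-pos : ∀ {n} (f : Fin n → ℕ) → 0 < sum f → ∃ λ i → 0 < f i
∑-pos {suc n} f pos with f zero in eq
... | suc _ = zero , subst (0 <_) (sym eq) z<s
... | zero  with i , fi>0 ← ∑-pos (f ∘ suc) pos = suc i , fi>0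

∑-== : ∀ {n} (r : Fin n) (f : Fin n → ℕ) → ∑[ i < n ] (indicator (i == r) * f i) ≡ f r
∑-== {suc n} zero f = begin
  1 * f zero + ∑[ i < n ] (0 * f (suc i)) ≡⟨ cong (1 * f zero +_) (∑-const n 0) ⟩
  1 * f zero + n * 0                      ≡⟨ cong₂ _+_ (*-identityˡ (f zero)) (*-zeroʳ n) ⟩
  f zero + 0                              ≡⟨ +-identityʳ (f zero) ⟩
  f zero                                  ∎
  where open ≡-Reasoning
∑-== {suc n} (suc r) f = ∑-== r (f ∘ suc)

∑-indicator-== : ∀ {n} (r : Fin n) → ∑[ i < n ] indicator (i == r) ≡ 1
∑-indicator-== r = trans (sum-cong-≗ (λ i → sym (*-identityʳ (indicator (i == r))))) (∑-== r (λ _ → 1))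

∑-*-const-factor : ∀ {n} (p q : Fin n → ℕ) → (∀ v w → p v ≡ p w) →
  n * ∑[ v < n ] (p v * q v) ≡ sum p * sum q
∑-*-const-factor {n} p q p-const = begin
  n * ∑[ v < n ] (p v * q v)              ≡⟨ ∑-const n _ ⟨
  ∑[ v < n ] ∑[ w < n ] (p w * q w)
    ≡⟨ sum-cong-≗ (λ v → sum-cong-≗ (λ w → cong (_* q w) (p-const w v))) ⟩
  ∑[ v < n ] ∑[ w < n ] (p v * q w)       ≡⟨ sum-cong-≗ (λ v → *-distribˡ-sum (p v) q) ⟨
  ∑[ v < n ] (p v * sum q)                ≡⟨ *-distribʳ-sum (sum q) p ⟨
  sum p * sum q                           ∎
  where open ≡-Reasoning

∑-↑ : ∀ m n (g : Fin (m + n) → ℕ) → sum g ≡ ∑[ i < m ] g (i ↑ˡ n) + ∑[ j < n ] g (m ↑ʳ j)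
∑-↑ zero    n g = refl
∑-↑ (suc m) n g = trans (cong (g zero +_) (∑-↑ m n (g ∘ suc))) (sym (+-assoc (g zero) _ _))

∑-combine : ∀ m n (g : Fin (m * n) → ℕ) → sum g ≡ ∑[ i < m ] ∑[ j < n ] g (combine i j)
∑-combine zero    n g = refl
∑-combine (suc m) n g =
  trans (∑-↑ n (m * n) g) (cong (∑[ j < n ] g (j ↑ˡ (m * n)) +_) (∑-combine m n (g ∘ (n ↑ʳ_))))

all any : ∀ {n} → (Fin n → Bool) → Bool
all {zero}  f = true
all {suc n} f = f zero ∧ all (f ∘ suc)
any {zero}  f = false
any {suc n} f = f zero ∨ any (f ∘ suc)

all⁺ : ∀ {n} {f : Fin n → Bool} → (∀ i → f i ≡ true) → all f ≡ true
all⁺ {zero}  h = refl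
all⁺ {suc n} h rewrite h zero = all⁺ (h ∘ suc)

all⁻ : ∀ {n} {f : Fin n → Bool} → all f ≡ true → ∀ i → f i ≡ true
all⁻ {suc n} {f} h i with f zero in eq
all⁻ {suc n} {f} h zero    | true = eq
all⁻ {suc n} {f} h (suc i) | true = all⁻ h i

all-cong : ∀ {n} {f g : Fin n → Bool} → (∀ i → f i ≡ g i) → all f ≡ all g
all-cong {zero}  h = refl
all-cong {suc n} h = cong₂ _∧_ (h zero) (all-cong (h ∘ suc))

any-cong : ∀ {n} {f g : Fin n → Bool} → (∀ i → f i ≡ g i) → any f ≡ any g
any-cong {zero}  h = refl
any-cong {suc n} h = cong₂ _∨_ (h zero) (any-cong (h ∘ suc))

all-∧ : ∀ {n} (f g : Fin n → Bool) → all (λ i → f i ∧ g i) ≡ all f ∧ all g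
all-∧ {zero}  f g = refl
all-∧ {suc n} f g rewrite all-∧ (f ∘ suc) (g ∘ suc) = ∧-interchange (f zero) (g zero) _ _

all-== : ∀ {n} (e : Fin n) (m : Fin n → Bool) → all (λ i → not ((i == e) ∧ m i)) ≡ not (m e)
all-== {suc n} zero    m =
  trans (cong (not (m zero) ∧_) (all⁺ {f = λ i → not ((suc i == zero) ∧ m (suc i))} (λ _ → refl)))
        (∧-identityʳ _)
all-== {suc n} (suc e) m = all-== e (m ∘ suc)

any⁺ : ∀ {n} {f : Fin n → Bool} (i : Fin n) → f i ≡ true → any f ≡ true
any⁺ {suc n} {f} zero    h rewrite h = refl
any⁺ {suc n} {f} (suc i) h = trans (cong (f zero ∨_) (any⁺ i h)) (∨-zeroʳ (f zero))

any⁻ : ∀ {n} {f : Fin n → Bool} → any f ≡ true → ∃ λ i → f i ≡ true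
any⁻ {suc n} {f} h with f zero in eq
... | true  = zero , eq
... | false with i , fi ← any⁻ h = suc i , fi

indicator-any≤∑ : ∀ {n} (f : Fin n → Bool) → indicator (any f) ≤ ∑[ i < n ] indicator (f i)
indicator-any≤∑ {zero}  f = z≤n
indicator-any≤∑ {suc n} f with f zero
... | true  = s≤s z≤n
... | false = indicator-any≤∑ (f ∘ suc)

indicator-all : ∀ {d} (f : Fin d → Bool) → indicator (all f) ≡ volume (λ i → indicator (f i))
indicator-all {zero}  f = refl
indicator-all {suc d} f =
  trans (indicator-∧ (f zero) (all (f ∘ suc))) (cong (indicator (f zero) *_) (indicator-all (f ∘ suc)))

meets : ∀ {n} → (Fin n → Bool) → (Fin n → Bool) → Bool
meets S S′ = any (λ i → S i ∧ S′ i)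

infix 4 _⊆_
_⊆_ : ∀ {n} → (Fin n → Bool) → (Fin n → Bool) → Set
S ⊆ T = ∀ i → S i ≡ true → T i ≡ true

⊆-antisym : ∀ {n} {S T : Fin n → Bool} → S ⊆ T → T ⊆ S → ∀ i → S i ≡ T i
⊆-antisym {S = S} {T} S⊆T T⊆S i with S i in Si | T i in Ti
... | false | false = refl
... | true  | true  = refl
... | true  | false with () ← trans (sym (S⊆T i Si)) Ti
... | false | true  with () ← trans (sym (T⊆S i Ti)) Si

size : ∀ {n} → (Fin n → Bool) → ℕ
size {n} S = ∑[ i < n ] indicator (S i)

size-∅ : ∀ n → size {n} (λ _ → false) ≡ 0
size-∅ n = trans (∑-const n 0) (*-zeroʳ n)

size-mono : ∀ {n} {S T : Fin n → Bool} → S ⊆ T → size S ≤ size T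
size-mono S⊆T = ∑-mono (λ i → indicator-mono (S⊆T i))

size-pos : ∀ {n} (S : Fin n → Bool) → 0 < size S → ∃ λ i → S i ≡ true
size-pos S pos with i , Si>0 ← ∑-pos (indicator ∘ S) pos = i , lemma (S i) Si>0
  where
  lemma : ∀ b → 0 < indicator b → b ≡ true
  lemma true _ = refl

size-split : ∀ {n} (S P : Fin n → Bool) →
  size S ≡ size (λ i → S i ∧ P i) + size (λ i → S i ∧ not (P i))
size-split S P =
  trans (sum-cong-≗ (λ i → indicator-split (S i) (P i)))
        (∑-distrib-+ (λ i → indicator (S i ∧ P i)) (λ i → indicator (S i ∧ not (P i))))

remove : ∀ {n} → Fin n → (Fin n → Bool) → Fin n → Bool
remove u S i = S i ∧ not (i == u)

remove-self : ∀ {n} (u : Fin n) (S : Fin n → Bool) → remove u S u ≡ false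
remove-self u S with u ≟ u
... | yes _   = ∧-zeroʳ (S u)
... | no  u≢u = contradiction refl u≢u

size-remove : ∀ {n} (S : Fin n → Bool) {u} → S u ≡ true → size S ≡ suc (size (remove u S))
size-remove {n} S {u} Su = begin
  size S                                                   ≡⟨ size-split S (_== u) ⟩
  size (λ i → S i ∧ (i == u)) + size (remove u S)            ≡⟨ cong (_+ size (remove u S)) singleton ⟩
  suc (size (remove u S))                                  ∎
  where
  open ≡-Reasoning
  singleton : size (λ i → S i ∧ (i == u)) ≡ 1
  singleton = begin
    ∑[ i < n ] indicator (S i ∧ (i == u))
      ≡⟨ sum-cong-≗ (λ i → trans (indicator-∧ (S i) (i == u)) (*-comm (indicator (S i)) _)) ⟩
    ∑[ i < n ] (indicator (i == u) * indicator (S i)) ≡⟨ ∑-== u (indicator ∘ S) ⟩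
    indicator (S u)                               ≡⟨ cong indicator Su ⟩
    1                                             ∎

⊆-remove : ∀ {n} {S T : Fin n → Bool} {u} → S ⊆ T → S u ≡ false → S ⊆ remove u T
⊆-remove {S = S} {T} {u} S⊆T Su i Si with i ≟ u
... | yes refl with () ← trans (sym Su) Si
... | no  _    = trans (cong (_∧ true) (S⊆T i Si)) refl

⊆-size<⇒∃-missing : ∀ {n} {S T : Fin n → Bool} → S ⊆ T → size S < size T →
  ∃ λ u → T u ≡ true × S u ≡ false
⊆-size<⇒∃-missing {suc n} {S} {T} S⊆T lt with S zero in eqS | T zero in eqT
... | false | true  = zero , eqT , eqS
... | true  | false with () ← trans (sym (S⊆T zero eqS)) eqT
... | true  | true  with u , Tu , Su ← ⊆-size<⇒∃-missing (S⊆T ∘ suc) (≤-pred lt) = suc u , Tu , Su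
... | false | false with u , Tu , Su ← ⊆-size<⇒∃-missing (S⊆T ∘ suc) lt = suc u , Tu , Su

⊆-size-≡⇒⊇ : ∀ {n} {S T : Fin n → Bool} → S ⊆ T → size S ≡ size T → T ⊆ S
⊆-size-≡⇒⊇ {S = S} {T} S⊆T same u Tu with S u in Su
... | true  = refl
... | false = contradiction (begin
  suc (size (remove u T)) ≡⟨ size-remove T Tu ⟨
  size T                  ≡⟨ same ⟨
  size S                  ≤⟨ size-mono (⊆-remove S⊆T Su) ⟩
  size (remove u T)       ∎) (1+n≰n)
  where open ≤-Reasoning

insert : ∀ {n} → Fin n → (Fin n → Bool) → Fin n → Bool
insert u S i = S i ∨ (i == u)

insert-remove : ∀ {n} {S : Fin n → Bool} {u} → S u ≡ true → ∀ i → insert u (remove u S) i ≡ S i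
insert-remove {S = S} {u} Su i with i ≟ u
... | yes refl = trans (∨-zeroʳ _) (sym Su)
... | no  _    = trans (∨-identityʳ _) (∧-identityʳ (S i))

-- Sums and counting over the points of a grid

volume-cong : ∀ {d} {a b : Fin d → ℕ} → (∀ i → a i ≡ b i) → volume a ≡ volume b
volume-cong {zero}  h = refl
volume-cong {suc d} h = cong₂ _*_ (h zero) (volume-cong (h ∘ suc))

volume-mono : ∀ {d} {a b : Fin d → ℕ} → (∀ i → a i ≤ b i) → volume a ≤ volume b
volume-mono {zero}  h = ≤-refl
volume-mono {suc d} h = *-mono-≤ (h zero) (volume-mono (h ∘ suc))

volume-const : ∀ d x → volume {d} (λ _ → x) ≡ x ^ d
volume-const zero    x = refl
volume-const (suc d) x = cong (x *_) (volume-const d x)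

volume-pos : ∀ {d} (a : Fin d → ℕ) → Positive a → 0 < volume a
volume-pos {zero}  a pos = z<s
volume-pos {suc d} a pos = *-mono-≤ (pos zero) (volume-pos (a ∘ suc) (pos ∘ suc))

infixr 5 _◂_
_◂_ : ∀ {d} {a : Fin (suc d) → ℕ} → Fin (a zero) → Point (a ∘ suc) → Point a
(x ◂ p) zero    = x
(x ◂ p) (suc i) = p i

[]ᴾ : {a : Fin 0 → ℕ} → Point a
[]ᴾ ()

∑ᴾ : ∀ {d} {a : Fin d → ℕ} → (Point a → ℕ) → ℕ
∑ᴾ {zero}      f = f []ᴾ
∑ᴾ {suc d} {a} f = ∑[ x < a zero ] ∑ᴾ (λ p → f (x ◂ p))

∑ᴾ-cong : ∀ {d} {a : Fin d → ℕ} {f g : Point a → ℕ} → (∀ p → f p ≡ g p) → ∑ᴾ f ≡ ∑ᴾ g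
∑ᴾ-cong {zero}  h = h _
∑ᴾ-cong {suc d} h = sum-cong-≗ (λ x → ∑ᴾ-cong (λ p → h (x ◂ p)))

∑ᴾ-mono : ∀ {d} {a : Fin d → ℕ} {f g : Point a → ℕ} → (∀ p → f p ≤ g p) → ∑ᴾ f ≤ ∑ᴾ g
∑ᴾ-mono {zero}  h = h _
∑ᴾ-mono {suc d} h = ∑-mono (λ x → ∑ᴾ-mono (λ p → h (x ◂ p)))

∑ᴾ-distrib-+ : ∀ {d} {a : Fin d → ℕ} (f g : Point a → ℕ) → ∑ᴾ (λ p → f p + g p) ≡ ∑ᴾ f + ∑ᴾ g
∑ᴾ-distrib-+ {zero}  f g = refl
∑ᴾ-distrib-+ {suc d} {a} f g =
  trans (sum-cong-≗ (λ x → ∑ᴾ-distrib-+ (f ∘ (x ◂_)) (g ∘ (x ◂_))))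
        (∑-distrib-+ (λ x → ∑ᴾ (f ∘ (x ◂_))) (λ x → ∑ᴾ (g ∘ (x ◂_))))

∑ᴾ-distribˡ-* : ∀ {d} {a : Fin d → ℕ} k (f : Point a → ℕ) → ∑ᴾ (λ p → k * f p) ≡ k * ∑ᴾ f
∑ᴾ-distribˡ-* {zero}  k f = refl
∑ᴾ-distribˡ-* {suc d} k f =
  trans (sum-cong-≗ (λ x → ∑ᴾ-distribˡ-* k (f ∘ (x ◂_))))
        (sym (*-distribˡ-sum k (λ x → ∑ᴾ (f ∘ (x ◂_)))))

∑ᴾ-∑-comm : ∀ {d} {a : Fin d → ℕ} {n} (f : Point a → Fin n → ℕ) →
  ∑ᴾ (λ p → ∑[ j < n ] f p j) ≡ ∑[ j < n ] ∑ᴾ (λ p → f p j)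
∑ᴾ-∑-comm {zero}  f = refl
∑ᴾ-∑-comm {suc d} f =
  trans (sum-cong-≗ (λ x → ∑ᴾ-∑-comm (f ∘ (x ◂_)))) (∑-comm (λ x j → ∑ᴾ (λ p → f (x ◂ p) j)))

∑ᴾ-volume : ∀ {d} {a : Fin d → ℕ} (g : (i : Fin d) → Fin (a i) → ℕ) →
  ∑ᴾ {a = a} (λ p → volume (λ i → g i (p i))) ≡ volume (λ i → sum (g i))
∑ᴾ-volume {zero}      g = refl
∑ᴾ-volume {suc d} {a} g = begin
  ∑[ x < a zero ] ∑ᴾ (λ p → g zero x * volume (λ i → g (suc i) (p i)))
    ≡⟨ sum-cong-≗ (λ x → trans (∑ᴾ-distribˡ-* (g zero x) (λ p → volume (λ i → g (suc i) (p i))))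
                                 (cong (g zero x *_) (∑ᴾ-volume {a = a ∘ suc} (g ∘ suc)))) ⟩
  ∑[ x < a zero ] (g zero x * volume (λ i → sum (g (suc i))))
    ≡⟨ *-distribʳ-sum (volume (λ i → sum (g (suc i)))) (g zero) ⟨
  sum (g zero) * volume (λ i → sum (g (suc i))) ∎
  where open ≡-Reasoning

count : ∀ {d} {a : Fin d → ℕ} → (Point a → Bool) → ℕ
count P = ∑ᴾ (indicator ∘ P)

count-cong : ∀ {d} {a : Fin d → ℕ} {P Q : Point a → Bool} → (∀ p → P p ≡ Q p) → count P ≡ count Q
count-cong h = ∑ᴾ-cong (λ p → cong indicator (h p))

count-mono : ∀ {d} {a : Fin d → ℕ} {P Q : Point a → Bool} →
  (∀ p → P p ≡ true → Q p ≡ true) → count P ≤ count Q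
count-mono h = ∑ᴾ-mono (λ p → indicator-mono (h p))

count-split : ∀ {d} {a : Fin d → ℕ} (P Q : Point a → Bool) →
  count P ≡ count (λ p → P p ∧ Q p) + count (λ p → P p ∧ not (Q p))
count-split P Q = trans (∑ᴾ-cong (λ p → indicator-split (P p) (Q p)))
  (∑ᴾ-distrib-+ (λ p → indicator (P p ∧ Q p)) (λ p → indicator (P p ∧ not (Q p))))

count-const-∧ : ∀ {d} {a : Fin d → ℕ} b (R : Point a → Bool) →
  count (λ p → b ∧ R p) ≡ indicator b * count R
count-const-∧ b R =
  trans (∑ᴾ-cong (λ p → indicator-∧ b (R p))) (∑ᴾ-distribˡ-* (indicator b) (indicator ∘ R))

count-true : ∀ {d} (a : Fin d → ℕ) → count {a = a} (λ _ → true) ≡ volume a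
count-true {d} a = begin
  ∑ᴾ {a = a} (λ _ → 1)
    ≡⟨ ∑ᴾ-cong {a = a} (λ _ → trans (volume-const d 1) (^-zeroˡ d)) ⟨
  ∑ᴾ {a = a} (λ _ → volume {d} (λ _ → 1))
    ≡⟨ ∑ᴾ-volume {a = a} (λ _ _ → 1) ⟩
  volume (λ i → ∑[ x < a i ] 1)
    ≡⟨ volume-cong (λ i → trans (∑-const (a i) 1) (*-identityʳ (a i))) ⟩
  volume a ∎
  where open ≡-Reasoning

count-pos : ∀ {d} {a : Fin d → ℕ} (P : Point a → Bool) → 0 < count P → ∃ λ p → P p ≡ true
count-pos {zero} P pos with P []ᴾ in eq
... | true = []ᴾ , eq
count-pos {suc d} P pos with x , pos′ ← ∑-pos _ pos with p , Pp ← count-pos (P ∘ (x ◂_)) pos′ = x ◂ p , Pp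

count-any : ∀ {d} {a : Fin d → ℕ} {n} (R : Fin n → Point a → Bool) →
  count (λ p → any (λ j → R j p)) ≤ ∑[ j < n ] count (R j)
count-any R = ≤-trans (∑ᴾ-mono (λ p → indicator-any≤∑ (λ j → R j p)))
                      (≤-reflexive (∑ᴾ-∑-comm (λ p j → indicator (R j p))))

DeterminedBy : ∀ {d} {a : Fin d → ℕ} → (Fin d → Bool) → (Point a → Bool) → Set
DeterminedBy {a = a} S P = ∀ (p q : Point a) → (∀ i → S i ≡ true → p i ≡ q i) → P p ≡ P q

∑-slices : ∀ m V (u p q : Fin m → ℕ) → (∀ x → u x * V ≡ p x * q x) → (∀ x y → p x ≡ p y) →
  sum u * (m * V) ≡ sum p * sum q
∑-slices m V u p q slice p-const = begin
  sum u * (m * V)            ≡⟨ x∙yz≈y∙xz (sum u) m V ⟩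
  m * (sum u * V)            ≡⟨ cong (m *_) (*-distribʳ-sum V u) ⟩
  m * ∑[ x < m ] (u x * V)   ≡⟨ cong (m *_) (sum-cong-≗ slice) ⟩
  m * ∑[ x < m ] (p x * q x) ≡⟨ ∑-*-const-factor p q p-const ⟩
  sum p * sum q              ∎
  where open ≡-Reasoning

count-∧-independent : ∀ {d} {a : Fin d → ℕ} (A : Fin d → Bool) (P Q : Point a → Bool) →
  DeterminedBy (not ∘ A) P → DeterminedBy A Q →
  count (λ p → P p ∧ Q p) * volume a ≡ count P * count Q
count-∧-independent {zero} A P Q _ _ =
  trans (*-identityʳ _) (indicator-∧ (P []ᴾ) (Q []ᴾ))
count-∧-independent {suc d} {a} A P Q hP hQ = by-first-coordinate (A zero) refl
  where
  P∧Qₓ Pₓ Qₓ : Fin (a zero) → ℕ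
  P∧Qₓ x = count (λ p → P (x ◂ p) ∧ Q (x ◂ p))
  Pₓ x = count (P ∘ (x ◂_))
  Qₓ x = count (Q ∘ (x ◂_))
  slice : ∀ x → P∧Qₓ x * volume (a ∘ suc) ≡ Pₓ x * Qₓ x
  slice x = count-∧-independent (A ∘ suc) (P ∘ (x ◂_)) (Q ∘ (x ◂_))
              (λ p q h → hP (x ◂ p) (x ◂ q) (λ { zero _ → refl ; (suc i) → h i }))
              (λ p q h → hQ (x ◂ p) (x ◂ q) (λ { zero _ → refl ; (suc i) → h i }))
  by-first-coordinate : ∀ b → A zero ≡ b → count (λ p → P p ∧ Q p) * volume a ≡ count P * count Q
  by-first-coordinate true  A0 = ∑-slices (a zero) (volume (a ∘ suc)) P∧Qₓ Pₓ Qₓ slice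
    (λ x y → count-cong (λ p → hP (x ◂ p) (y ◂ p)
      (λ { zero ¬A0 → contradiction (trans (sym ¬A0) (cong not A0)) λ () ; (suc i) _ → refl })))
  by-first-coordinate false A0 = trans
    (∑-slices (a zero) (volume (a ∘ suc)) P∧Qₓ Qₓ Pₓ (λ x → trans (slice x) (*-comm (Pₓ x) (Qₓ x)))
      (λ x y → count-cong (λ p → hQ (x ◂ p) (y ◂ p)
        (λ { zero A0′ → contradiction (trans (sym A0′) A0) λ () ; (suc i) _ → refl }))))
    (*-comm (count Q) (count P))

-- The Lovász local lemma in counting form

^-gap : ∀ D j {x y} → j ≤ D → D ^ j * x ≤ suc D ^ j * y → D ^ D * x ≤ suc D ^ D * y
^-gap D j {x} {y} j≤D gap with r , refl ← m≤n⇒∃[o]m+o≡n j≤D = begin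
  D ^ (j + r) * x               ≡⟨ cong (_* x) (^-distribˡ-+-* D j r) ⟩
  D ^ j * D ^ r * x             ≡⟨ xy∙z≈y∙xz (D ^ j) (D ^ r) x ⟩
  D ^ r * (D ^ j * x)           ≤⟨ *-mono-≤ (^-monoˡ-≤ r (n≤1+n D)) gap ⟩
  suc D ^ r * (suc D ^ j * y)   ≡⟨ xy∙z≈y∙xz (suc D ^ j) (suc D ^ r) y ⟨
  suc D ^ j * suc D ^ r * y     ≡⟨ cong (_* y) (^-distribˡ-+-* (suc D) j r) ⟨
  suc D ^ (j + r) * y           ∎
  where open ≤-Reasoning

-- The arithmetic of share-bounded-step below: V is the size of the space, p the size of the
-- event e, X that of e among the points avoiding T, and Fs, Ft the numbers of points avoiding T₂
-- and T.
share-bound : ∀ {D j V p X Fs Ft} → 0 < V → j ≤ D → p * suc D ^ suc D ≤ V * D ^ D →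
  X * V ≤ Fs * p → D ^ j * Fs ≤ suc D ^ j * Ft → suc D * X ≤ Ft
share-bound {D} {j} {V} {p} {X} {Fs} {Ft} 0<V j≤D rare X≤ gap =
  *-cancelˡ-≤ (suc D ^ D * V) {{m*n≢0 _ _ {{m^n≢0 (suc D) D}} {{>-nonZero 0<V}}}} (begin
    suc D ^ D * V * (suc D * X)   ≡⟨ regroup (suc D) (suc D ^ D) V X ⟩
    X * V * suc D ^ suc D         ≤⟨ *-monoˡ-≤ (suc D ^ suc D) X≤ ⟩
    Fs * p * suc D ^ suc D        ≡⟨ *-assoc Fs p _ ⟩
    Fs * (p * suc D ^ suc D)      ≤⟨ *-monoʳ-≤ Fs rare ⟩
    Fs * (V * D ^ D)              ≡⟨ x∙yz≈zy∙x Fs V (D ^ D) ⟩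
    D ^ D * V * Fs                ≡⟨ xy∙z≈y∙xz (D ^ D) V Fs ⟩
    V * (D ^ D * Fs)              ≤⟨ *-monoʳ-≤ V (^-gap D j j≤D gap) ⟩
    V * (suc D ^ D * Ft)          ≡⟨ x∙yz≈yx∙z V (suc D ^ D) Ft ⟩
    suc D ^ D * V * Ft            ∎)
  where
  open ≤-Reasoning
  regroup : ∀ s q v x → q * v * (s * x) ≡ x * v * (s * q)
  regroup = solve-∀

share⇒ratio : ∀ D X Y → suc D * X ≤ X + Y → D * (X + Y) ≤ suc D * Y
share⇒ratio D X Y share = begin
  D * (X + Y)       ≡⟨ *-distribˡ-+ D X Y ⟩
  D * X + D * Y     ≤⟨ +-monoˡ-≤ (D * Y) (+-cancelˡ-≤ X (D * X) Y share) ⟩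
  Y + D * Y         ∎
  where open ≤-Reasoning

-- bad e is an event of the uniform space Point a determined by the coordinates in support e,
-- of probability at most D^D / (D+1)^(D+1), and the supports of at most D other events meet support e.
module LovászLocalLemma {n} {a : Fin n → ℕ} {E} (D : ℕ)
  (bad : Fin E → Point a → Bool) (support : Fin E → Fin n → Bool)
  (determined : ∀ e → DeterminedBy (support e) (bad e))
  (rare : ∀ e → count (bad e) * suc D ^ suc D ≤ volume a * D ^ D)
  (sparse : ∀ e → size (remove e (meets (support e) ∘ support)) ≤ D)
  (1≤D : 1 ≤ D) (0<volume : 0 < volume a)
  where

  avoids : (Fin E → Bool) → Point a → Bool
  avoids T σ = all (λ e → not (T e ∧ bad e σ))

  good : (Fin E → Bool) → ℕ
  good T = count (avoids T)

  good-cong : ∀ {S T} → (∀ e → S e ≡ T e) → good S ≡ good T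
  good-cong h = count-cong (λ σ → all-cong (λ e → cong (λ b → not (b ∧ bad e σ)) (h e)))

  avoids-antitone : ∀ {S T} → S ⊆ T → ∀ σ → avoids T σ ≡ true → avoids S σ ≡ true
  avoids-antitone {S} {T} S⊆T σ avT = all⁺ (λ e → pointwise e (all⁻ avT e))
    where
    pointwise : ∀ e → not (T e ∧ bad e σ) ≡ true → not (S e ∧ bad e σ) ≡ true
    pointwise e ok with S e in Se
    ... | false = refl
    ... | true rewrite S⊆T e Se = ok

  avoids-insert : ∀ e T σ → avoids (insert e T) σ ≡ avoids T σ ∧ not (bad e σ)
  avoids-insert e T σ = begin
    all (λ x → not ((T x ∨ (x == e)) ∧ bad x σ))
      ≡⟨ all-cong (λ x → trans (cong not (∧-distribʳ-∨ (bad x σ) (T x) (x == e)))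
                               (deMorgan₂ (T x ∧ bad x σ) ((x == e) ∧ bad x σ))) ⟩
    all (λ x → not (T x ∧ bad x σ) ∧ not ((x == e) ∧ bad x σ))
      ≡⟨ all-∧ (λ x → not (T x ∧ bad x σ)) (λ x → not ((x == e) ∧ bad x σ)) ⟩
    avoids T σ ∧ all (λ x → not ((x == e) ∧ bad x σ))
      ≡⟨ cong (avoids T σ ∧_) (all-== e (λ x → bad x σ)) ⟩
    avoids T σ ∧ not (bad e σ) ∎
    where open ≡-Reasoning

  good-insert : ∀ e T → good T ≡ count (λ σ → avoids T σ ∧ bad e σ) + good (insert e T)
  good-insert e T = trans (count-split (avoids T) (bad e))
    (cong (count (λ σ → avoids T σ ∧ bad e σ) +_) (sym (count-cong (avoids-insert e T))))

  avoids-independent : ∀ e (T : Fin E → Bool) → DeterminedBy (not ∘ support e)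
    (avoids (λ x → T x ∧ not (meets (support e) (support x))))
  avoids-independent e T σ τ agree = all-cong pointwise
    where
    pointwise : ∀ x → not ((T x ∧ not (meets (support e) (support x))) ∧ bad x σ)
                    ≡ not ((T x ∧ not (meets (support e) (support x))) ∧ bad x τ)
    pointwise x with T x | meets (support e) (support x) in disjoint
    ... | false | _     = refl
    ... | true  | true  = refl
    ... | true  | false = cong not (determined x σ τ (λ i xi → agree i (outside i xi)))
      where
      outside : ∀ i → support x i ≡ true → not (support e i) ≡ true
      outside i xi with support e i in ei
      ... | false = refl
      ... | true  with () ← trans (sym (any⁺ {f = λ i → support e i ∧ support x i} i
                                    (trans (cong₂ _∧_ ei xi) refl))) disjoint

  ShareBounded : (Fin E → Bool) → Set
  ShareBounded T = ∀ e → T e ≡ false → D * good T ≤ suc D * good (insert e T)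

  -- Adding the j events of T ∖ S one at a time, each costing at most a factor D/(D+1).
  growth : ∀ m → (∀ S → size S < m → ShareBounded S) →
    ∀ j S T → S ⊆ T → size S + j ≡ size T → size T ≤ m → D ^ j * good S ≤ suc D ^ j * good T
  growth m ih zero S T S⊆T sizes _ = ≤-reflexive (cong (1 *_) (good-cong
    (⊆-antisym S⊆T (⊆-size-≡⇒⊇ S⊆T (trans (sym (+-identityʳ (size S))) sizes)))))
  growth m ih (suc j) S T S⊆T sizes T≤m
    with u , Tu , Su ← ⊆-size<⇒∃-missing S⊆T (subst (size S <_) sizes (m<m+n (size S) z<s)) = begin
    D * D ^ j * good S
      ≡⟨ *-assoc D (D ^ j) (good S) ⟩
    D * (D ^ j * good S)
      ≤⟨ *-monoʳ-≤ D fewer ⟩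
    D * (suc D ^ j * good T′)
      ≡⟨ x∙yz≈y∙xz D (suc D ^ j) (good T′) ⟩
    suc D ^ j * (D * good T′)
      ≤⟨ *-monoʳ-≤ (suc D ^ j) (ih T′ T′<m u (remove-self u T)) ⟩
    suc D ^ j * (suc D * good (insert u T′))
      ≡⟨ cong (λ g → suc D ^ j * (suc D * g)) (good-cong (insert-remove Tu)) ⟩
    suc D ^ j * (suc D * good T)
      ≡⟨ x∙yz≈yx∙z (suc D ^ j) (suc D) (good T) ⟩
    suc D * suc D ^ j * good T ∎
    where
    open ≤-Reasoning
    T′ = remove u T
    T′<m : size T′ < m
    T′<m = subst (_≤ m) (size-remove T Tu) T≤m
    fewer : D ^ j * good S ≤ suc D ^ j * good T′
    fewer = growth m ih j S T′ (⊆-remove S⊆T Su)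
              (suc-injective (trans (sym (+-suc (size S) j)) (trans sizes (size-remove T Tu)))) (<⇒≤ T′<m)

  -- The share of the event e among the points avoiding T is at most 1/(D+1): split T
  -- into the events T₁ meeting e and the rest T₂; e is independent of avoiding T₂, and
  -- avoiding the at most D events of T₁ on top of T₂ costs at most a factor (D/(D+1))^D.
  share-bounded-step : ∀ m → (∀ S → size S < m → ShareBounded S) → ∀ T → size T ≤ m → ShareBounded T
  share-bounded-step m ih T T≤m e Te =
    subst (λ g → D * g ≤ suc D * good (insert e T)) (sym (good-insert e T))
      (share⇒ratio D X (good (insert e T)) (subst (suc D * X ≤_) (good-insert e T) share))
    where
    nbr T₁ T₂ : Fin E → Bool
    nbr x = meets (support e) (support x)
    T₁ x = T x ∧ nbr x
    T₂ x = T x ∧ not (nbr x)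
    X = count (λ σ → avoids T σ ∧ bad e σ)
    T₂⊆T : T₂ ⊆ T
    T₂⊆T x T₂x = ∧-conicalˡ (T x) _ T₂x
    T₁⊆dependents : T₁ ⊆ remove e (meets (support e) ∘ support)
    T₁⊆dependents x T₁x with x ≟ e
    ... | yes refl with () ← trans (sym Te) (∧-conicalˡ (T e) _ T₁x)
    ... | no  _    = trans (cong (_∧ true) (∧-conicalʳ (T x) _ T₁x)) refl
    X-bound : X * volume a ≤ good T₂ * count (bad e)
    X-bound = begin
      X * volume a
        ≤⟨ *-monoˡ-≤ (volume a) (count-mono (λ σ avT∧bad →
             trans (cong (_∧ bad e σ) (avoids-antitone T₂⊆T σ (∧-conicalˡ _ _ avT∧bad))) (∧-conicalʳ _ _ avT∧bad))) ⟩
      count (λ σ → avoids T₂ σ ∧ bad e σ) * volume a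
        ≡⟨ count-∧-independent (support e) (avoids T₂) (bad e) (avoids-independent e T) (determined e) ⟩
      good T₂ * count (bad e) ∎
      where open ≤-Reasoning
    share : suc D * X ≤ good T
    share = share-bound 0<volume (≤-trans (size-mono T₁⊆dependents) (sparse e)) (rare e) X-bound
      (growth m ih (size T₁) T₂ T T₂⊆T (trans (+-comm (size T₂) (size T₁)) (sym (size-split T nbr))) T≤m)

  share-bounded : ∀ T → ShareBounded T
  share-bounded T = below (suc (size T)) T ≤-refl
    where
    below : ∀ m T → size T < m → ShareBounded T
    below (suc m) T T<m = share-bounded-step m (below m) T (≤-pred T<m)

  avoidable : ∃ λ σ → ∀ e → bad e σ ≡ false
  avoidable =
    let σ , avoids-all = count-pos (avoids (λ _ → true)) positive
    in σ , λ e → trans (sym (not-involutive (bad e σ))) (cong not (all⁻ avoids-all e))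
    where
    everything = size {E} (λ _ → true)
    good-∅ : good (λ _ → false) ≡ volume a
    good-∅ = trans (count-cong (λ σ → all⁺ {f = λ e → not (false ∧ bad e σ)} (λ _ → refl))) (count-true a)
    all-growth : D ^ everything * volume a ≤ suc D ^ everything * good (λ _ → true)
    all-growth = begin
      D ^ everything * volume a
        ≡⟨ cong (D ^ everything *_) good-∅ ⟨
      D ^ everything * good (λ _ → false)
        ≤⟨ growth everything (λ S _ → share-bounded S) everything (λ _ → false) (λ _ → true)
             (λ _ ()) (cong (_+ everything) (size-∅ E)) ≤-refl ⟩
      suc D ^ everything * good (λ _ → true) ∎
      where open ≤-Reasoning
    positive : 0 < good (λ _ → true)
    positive = >-nonZero⁻¹ _ {{m*n≢0⇒n≢0 (suc D ^ everything) {{>-nonZero (<-≤-trans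
      (*-mono-≤ (m^n>0 D {{>-nonZero 1≤D}} everything) 0<volume) all-growth)}}}}

-- Monochromatic sets of a colouring

module _ {c : ℕ} where

  constantOn : ∀ {N} → (Fin N → Bool) → Fin c → Point {N} (λ _ → c) → Bool
  constantOn S k σ = all (λ i → not (S i) ∨ (σ i == k))

  monochromatic : ∀ {N} → (Fin N → Bool) → Point {N} (λ _ → c) → Bool
  monochromatic S σ = any (λ k → constantOn S k σ)

  count-constantOn : ∀ {N} (S : Fin N → Bool) k → count (constantOn S k) * c ^ size S ≡ c ^ N
  count-constantOn {zero}  S k = refl
  count-constantOn {suc N} S k with S zero
  ... | true  = begin
    ∑[ v < c ] count (λ σ → (v == k) ∧ constantOn (S ∘ suc) k σ) * c ^ suc (size (S ∘ suc))
      ≡⟨ cong (_* c ^ suc (size (S ∘ suc))) (trans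
           (sum-cong-≗ (λ v → count-const-∧ (v == k) (constantOn (S ∘ suc) k)))
           (∑-== k (λ _ → count (constantOn (S ∘ suc) k)))) ⟩
    count (constantOn (S ∘ suc) k) * (c * c ^ size (S ∘ suc))
      ≡⟨ x∙yz≈y∙xz (count (constantOn (S ∘ suc) k)) c (c ^ size (S ∘ suc)) ⟩
    c * (count (constantOn (S ∘ suc) k) * c ^ size (S ∘ suc))
      ≡⟨ cong (c *_) (count-constantOn (S ∘ suc) k) ⟩
    c * c ^ N ∎
    where open ≡-Reasoning
  ... | false = begin
    ∑[ v < c ] count (constantOn (S ∘ suc) k) * c ^ size (S ∘ suc)
      ≡⟨ cong (_* c ^ size (S ∘ suc)) (∑-const c _) ⟩
    c * count (constantOn (S ∘ suc) k) * c ^ size (S ∘ suc)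
      ≡⟨ *-assoc c _ _ ⟩
    c * (count (constantOn (S ∘ suc) k) * c ^ size (S ∘ suc))
      ≡⟨ cong (c *_) (count-constantOn (S ∘ suc) k) ⟩
    c * c ^ N ∎
    where open ≡-Reasoning

  count-monochromatic : ∀ {N} (S : Fin N → Bool) → count (monochromatic S) * c ^ size S ≤ c * c ^ N
  count-monochromatic {N} S = begin
    count (monochromatic S) * c ^ size S
      ≤⟨ *-monoˡ-≤ (c ^ size S) (count-any (constantOn S)) ⟩
    ∑[ k < c ] count (constantOn S k) * c ^ size S
      ≡⟨ *-distribʳ-sum (c ^ size S) (λ k → count (constantOn S k)) ⟩
    ∑[ k < c ] (count (constantOn S k) * c ^ size S)
      ≡⟨ sum-cong-≗ (count-constantOn S) ⟩
    ∑[ k < c ] (c ^ N)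
      ≡⟨ ∑-const c (c ^ N) ⟩
    c * c ^ N ∎
    where open ≤-Reasoning

  monochromatic-determined : ∀ {N} (S : Fin N → Bool) → DeterminedBy S (monochromatic S)
  monochromatic-determined S σ τ σ≗τ = any-cong (λ k → all-cong (λ i → pointwise i k))
    where
    pointwise : ∀ i k → not (S i) ∨ (σ i == k) ≡ not (S i) ∨ (τ i == k)
    pointwise i k with S i in Si
    ... | false = refl
    ... | true  = cong (_== k) (σ≗τ i Si)

-- Boxes as events on the colourings of the grid points

encode : ∀ {d} {a : Fin d → ℕ} → Point a → Fin (volume a)
encode {zero}  p = zero
encode {suc d} p = combine (p zero) (encode (p ∘ suc))

decode : ∀ {d} {a : Fin d → ℕ} → Fin (volume a) → Point a
decode {suc d} {a} k = proj₁ x,k′ ◂ decode (proj₂ x,k′)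
  where x,k′ = remQuot (volume (a ∘ suc)) k

decode-combine : ∀ {d} {a : Fin (suc d) → ℕ} (x : Fin (a zero)) (k : Fin (volume (a ∘ suc))) i →
  decode {a = a} (combine x k) i ≡ _◂_ {a = a} x (decode k) i
decode-combine {a = a} x k i =
  cong (λ (x , k) → _◂_ {a = a} x (decode k) i) (remQuot-combine {k = volume (a ∘ suc)} x k)

decode-encode : ∀ {d} {a : Fin d → ℕ} (p : Point a) i → decode (encode p) i ≡ p i
decode-encode {suc d} {a} p i = trans (decode-combine (p zero) (encode (p ∘ suc)) i) (lemma i)
  where
  lemma : ∀ i → _◂_ {a = a} (p zero) (decode (encode (p ∘ suc))) i ≡ p i
  lemma zero    = refl
  lemma (suc i) = decode-encode (p ∘ suc) i

encode-decode : ∀ {d} {a : Fin d → ℕ} (k : Fin (volume a)) → encode {a = a} (decode k) ≡ k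
encode-decode {zero}  zero = refl
encode-decode {suc d} {a} k =
  trans (cong (combine (proj₁ x,k′)) (encode-decode {a = a ∘ suc} (proj₂ x,k′)))
        (combine-remQuot {a zero} (volume (a ∘ suc)) k)
  where x,k′ = remQuot {a zero} (volume (a ∘ suc)) k

encode-cong : ∀ {d} {a : Fin d → ℕ} {p q : Point a} → (∀ i → p i ≡ q i) → encode p ≡ encode q
encode-cong {zero}  h = refl
encode-cong {suc d} h = cong₂ combine (h zero) (encode-cong (h ∘ suc))

Extensional : ∀ {d} {a : Fin d → ℕ} → (Point a → ℕ) → Set
Extensional {a = a} f = ∀ (p q : Point a) → (∀ i → p i ≡ q i) → f p ≡ f q

∑-decode : ∀ {d} {a : Fin d → ℕ} (f : Point a → ℕ) → Extensional f →
  ∑[ k < volume a ] f (decode k) ≡ ∑ᴾ f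
∑-decode {zero}      f ext = trans (+-identityʳ _) (ext _ _ (λ ()))
∑-decode {suc d} {a} f ext = begin
  ∑[ k < volume a ] f (decode k)
    ≡⟨ ∑-combine (a zero) (volume (a ∘ suc)) (f ∘ decode) ⟩
  ∑[ x < a zero ] ∑[ k < volume (a ∘ suc) ] f (decode (combine x k))
    ≡⟨ sum-cong-≗ (λ x → sum-cong-≗ (λ k → ext _ _ (decode-combine x k))) ⟩
  ∑[ x < a zero ] ∑[ k < volume (a ∘ suc) ] f (x ◂ decode k)
    ≡⟨ sum-cong-≗ (λ x → ∑-decode (f ∘ (x ◂_))
         (λ p q p≗q → ext _ _ λ { zero → refl ; (suc i) → p≗q i })) ⟩
  ∑[ x < a zero ] ∑ᴾ (f ∘ (x ◂_))
    ∎
  where open ≡-Reasoning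

infix 4 _<ᵇ_
_<ᵇ_ : ∀ {n} → Fin n → Fin n → Bool
i <ᵇ j = does (i <? j)

<ᵇ-irrefl : ∀ {n} (i : Fin n) → (i <ᵇ i) ≡ false
<ᵇ-irrefl i = dec-false (i <? i) (<-irrefl refl)

<ᵇ⇒≢ : ∀ {n} {i j : Fin n} → (i <ᵇ j) ≡ true → i ≢ j
<ᵇ⇒≢ {i = i} i<ᵇj refl with () ← trans (sym i<ᵇj) (<ᵇ-irrefl i)

trichotomy : ∀ {n} (r t : Fin n) → indicator (r <ᵇ t) + indicator (t <ᵇ r) + indicator (t == r) ≡ 1
trichotomy r t with <-cmp r t
... | tri< r<t r≢t _
  rewrite dec-true (r <? t) r<t | dec-false (t <? r) (<-asym r<t) | dec-false (t ≟ r) (r≢t ∘ sym) = refl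
... | tri≈ _ refl _ rewrite <ᵇ-irrefl r | dec-true (r ≟ r) refl = refl
... | tri> _ r≢t t<r
  rewrite dec-false (r <? t) (<-asym t<r) | dec-true (t <? r) t<r | dec-false (t ≟ r) (r≢t ∘ sym) = refl

pair-through-split : ∀ {n} (r b c : Fin n) → indicator ((b <ᵇ c) ∧ ((r == b) ∨ (r == c)))
  ≡ indicator (b == r) * indicator (r <ᵇ c) + indicator (c == r) * indicator (b <ᵇ r)
pair-through-split r b c rewrite ==-comm r b | ==-comm r c with b ≟ r | c ≟ r
... | yes refl | yes refl rewrite <ᵇ-irrefl b = refl
... | yes refl | no  _    =
  trans (cong indicator (∧-identityʳ (b <ᵇ c))) (sym (trans (+-identityʳ _) (+-identityʳ _)))
... | no  _    | yes refl = trans (cong indicator (∧-identityʳ (b <ᵇ c))) (sym (+-identityʳ _))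
... | no  _    | no  _    = cong indicator (∧-zeroʳ (b <ᵇ c))

∑-< : ∀ {n} (r : Fin n) → ∑[ t < n ] indicator (r <ᵇ t) + ∑[ t < n ] indicator (t <ᵇ r) ≡ n ∸ 1
∑-< {n} r = begin
  sum above + sum below                     ≡⟨ m+n∸n≡m _ 1 ⟨
  sum above + sum below + 1 ∸ 1             ≡⟨ cong (λ k → sum above + sum below + k ∸ 1) (∑-indicator-== r) ⟨
  sum above + sum below + sum same ∸ 1     ≡⟨ cong (λ k → k + sum same ∸ 1) (∑-distrib-+ above below) ⟨
  ∑[ t < n ] (above t + below t) + sum same ∸ 1
    ≡⟨ cong (_∸ 1) (∑-distrib-+ (λ t → above t + below t) same) ⟨
  ∑[ t < n ] (above t + below t + same t) ∸ 1
    ≡⟨ cong (_∸ 1) (trans (sum-cong-≗ (trichotomy r)) (trans (∑-const n 1) (*-identityʳ n))) ⟩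
  n ∸ 1                                     ∎
  where
  open ≡-Reasoning
  above below same : Fin n → ℕ
  above t = indicator (r <ᵇ t)
  below t = indicator (t <ᵇ r)
  same t = indicator (t == r)

pairs-through : ∀ {n} (r : Fin n) →
  ∑[ b < n ] ∑[ c < n ] indicator ((b <ᵇ c) ∧ ((r == b) ∨ (r == c))) ≡ n ∸ 1
pairs-through {n} r = begin
  ∑[ b < n ] ∑[ c < n ] indicator ((b <ᵇ c) ∧ ((r == b) ∨ (r == c)))
    ≡⟨ sum-cong-≗ (λ b → trans (sum-cong-≗ (pair-through-split r b)) (∑-distrib-+ (left b) (right b))) ⟩
  ∑[ b < n ] (sum (left b) + sum (right b))
    ≡⟨ ∑-distrib-+ (sum ∘ left) (sum ∘ right) ⟩
  ∑[ b < n ] sum (left b) + ∑[ b < n ] sum (right b)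
    ≡⟨ cong₂ _+_ (trans (sum-cong-≗ (λ b → sym (*-distribˡ-sum (indicator (b == r)) (λ c → indicator (r <ᵇ c)))))
                        (∑-== r (λ _ → ∑[ c < n ] indicator (r <ᵇ c))))
                 (sum-cong-≗ (λ b → ∑-== r (λ _ → indicator (b <ᵇ r)))) ⟩
  ∑[ c < n ] indicator (r <ᵇ c) + ∑[ b < n ] indicator (b <ᵇ r)
    ≡⟨ ∑-< r ⟩
  n ∸ 1 ∎
  where
  open ≡-Reasoning
  left right : Fin n → Fin n → ℕ
  left  b c = indicator (b == r) * indicator (r <ᵇ c)
  right b c = indicator (c == r) * indicator (b <ᵇ r)

∑-endpoints : ∀ {n} {l h : Fin n} → l ≢ h → ∑[ t < n ] indicator ((t == l) ∨ (t == h)) ≡ 2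
∑-endpoints {n} {l} {h} l≢h = begin
  ∑[ t < n ] indicator ((t == l) ∨ (t == h))
    ≡⟨ sum-cong-≗ disjoint ⟩
  ∑[ t < n ] (indicator (t == l) + indicator (t == h))
    ≡⟨ ∑-distrib-+ (λ t → indicator (t == l)) (λ t → indicator (t == h)) ⟩
  ∑[ t < n ] indicator (t == l) + ∑[ t < n ] indicator (t == h)
    ≡⟨ cong₂ _+_ (∑-indicator-== l) (∑-indicator-== h) ⟩
  2 ∎
  where
  open ≡-Reasoning
  disjoint : ∀ t → indicator ((t == l) ∨ (t == h)) ≡ indicator (t == l) + indicator (t == h)
  disjoint t with t ≟ l
  ... | yes refl rewrite dec-false (t ≟ h) l≢h = refl
  ... | no  _    = refl

module _ {d} {a : Fin d → ℕ} where

  ordered : Point a → Point a → Bool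
  ordered p q = all (λ i → p i <ᵇ q i)

  inBox : Point a → Point a → Point a → Bool
  inBox l h r = all (λ i → (r i == l i) ∨ (r i == h i))

  ∑ᴾ-inBox : ∀ {l h} → ordered l h ≡ true → ∑ᴾ (indicator ∘ inBox l h) ≡ 2 ^ d
  ∑ᴾ-inBox {l} {h} l<h = begin
    ∑ᴾ (indicator ∘ inBox l h)
      ≡⟨ ∑ᴾ-cong (λ r → indicator-all (λ i → (r i == l i) ∨ (r i == h i))) ⟩
    ∑ᴾ (λ r → volume (λ i → indicator ((r i == l i) ∨ (r i == h i))))
      ≡⟨ ∑ᴾ-volume (λ i t → indicator ((t == l i) ∨ (t == h i))) ⟩
    volume (λ i → ∑[ t < a i ] indicator ((t == l i) ∨ (t == h i)))
      ≡⟨ volume-cong (λ i → ∑-endpoints (corners-differ i)) ⟩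
    volume {d} (λ _ → 2)
      ≡⟨ volume-const d 2 ⟩
    2 ^ d ∎
    where
    open ≡-Reasoning
    corners-differ : ∀ i → l i ≢ h i
    corners-differ i = <ᵇ⇒≢ (all⁻ l<h i)

  ordered-inBox-volume : ∀ p q r → indicator (ordered p q ∧ inBox p q r)
    ≡ volume (λ i → indicator ((p i <ᵇ q i) ∧ ((r i == p i) ∨ (r i == q i))))
  ordered-inBox-volume p q r = trans
    (cong indicator (sym (all-∧ (λ i → p i <ᵇ q i) (λ i → (r i == p i) ∨ (r i == q i)))))
    (indicator-all (λ i → (p i <ᵇ q i) ∧ ((r i == p i) ∨ (r i == q i))))

  ∑ᴾ-boxes-through : ∀ r →
    ∑ᴾ (λ p → ∑ᴾ (λ q → indicator (ordered p q ∧ inBox p q r))) ≡ volume (λ i → a i ∸ 1)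
  ∑ᴾ-boxes-through r = begin
    ∑ᴾ (λ p → ∑ᴾ (λ q → indicator (ordered p q ∧ inBox p q r)))
      ≡⟨ ∑ᴾ-cong (λ p → trans (∑ᴾ-cong (λ q → ordered-inBox-volume p q r))
                              (∑ᴾ-volume (λ i t → φ i (p i) t))) ⟩
    ∑ᴾ (λ p → volume (λ i → ∑[ t < a i ] φ i (p i) t))
      ≡⟨ ∑ᴾ-volume (λ i s → ∑[ t < a i ] φ i s t) ⟩
    volume (λ i → ∑[ s < a i ] ∑[ t < a i ] φ i s t)
      ≡⟨ volume-cong (λ i → pairs-through (r i)) ⟩
    volume (λ i → a i ∸ 1) ∎
    where
    open ≡-Reasoning
    φ : (i : Fin d) → Fin (a i) → Fin (a i) → ℕ
    φ i s t = indicator ((s <ᵇ t) ∧ ((r i == s) ∨ (r i == t)))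

low high : ∀ {n} → Fin n → Fin n → Fin n
low  x y = if x <ᵇ y then x else y
high x y = if x <ᵇ y then y else x

low<ᵇhigh : ∀ {n} {x y : Fin n} → x ≢ y → (low x y <ᵇ high x y) ≡ true
low<ᵇhigh {x = x} {y} x≢y with <-cmp x y
... | tri< x<y _ _ rewrite dec-true (x <? y) x<y = dec-true (x <? y) x<y
... | tri≈ _ x≡y _ = contradiction x≡y x≢y
... | tri> _ _ y<x rewrite dec-false (x <? y) (<-asym y<x) = dec-true (y <? x) y<x

low-high-endpoints : ∀ {n} (x y t : Fin n) → ((t == low x y) ∨ (t == high x y)) ≡ ((t == x) ∨ (t == y))
low-high-endpoints x y t with x <ᵇ y
... | true  = refl
... | false = ∨-comm (t == y) (t == x)

boxPoint-if : ∀ {d} {a : Fin d → ℕ} (B : Box a) s i → boxPoint B s i ≡ (if s i then Box.hi B i else Box.lo B i)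
boxPoint-if B s i with s i
... | true  = refl
... | false = refl

endpoint-if : ∀ {n} {t l h : Fin n} → ((t == l) ∨ (t == h)) ≡ true → (if t == h then h else l) ≡ t
endpoint-if {t = t} {l} {h} t∈ with t ≟ h | t ≟ l
... | yes t≡h | _        = sym t≡h
... | no  _   | yes t≡l  = sym t≡l
... | no  _   | no  _    with () ← t∈

-- Events are indexed by all pairs (lo, hi) of points; only the proper pairs, with lo < hi in every
-- coordinate, stand for a box, and the others have no points and are never bad.
module BoxEvents {d} (a : Fin d → ℕ) where

  N : ℕ
  N = volume a

  point : Fin N → Point a
  point = decode

  lo hi : Fin (N * N) → Point a
  lo e = point (proj₁ (remQuot {N} N e))
  hi e = point (proj₂ (remQuot {N} N e))

  proper : Fin (N * N) → Bool
  proper e = ordered (lo e) (hi e)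

  pointsOf : Fin (N * N) → Fin N → Bool
  pointsOf e k = proper e ∧ inBox (lo e) (hi e) (point k)

  size-pointsOf : ∀ e → proper e ≡ true → size (pointsOf e) ≡ 2 ^ d
  size-pointsOf e proper-e = begin
    ∑[ k < N ] indicator (proper e ∧ inBox (lo e) (hi e) (point k))
      ≡⟨ sum-cong-≗ (λ k → cong (λ b → indicator (b ∧ inBox (lo e) (hi e) (point k))) proper-e) ⟩
    ∑[ k < N ] indicator (inBox (lo e) (hi e) (point k))
      ≡⟨ ∑-decode (indicator ∘ inBox (lo e) (hi e))
           (λ p q p≗q → cong indicator (all-cong (λ i →
              cong (λ x → (x == lo e i) ∨ (x == hi e i)) (p≗q i)))) ⟩
    ∑ᴾ (indicator ∘ inBox (lo e) (hi e))
      ≡⟨ ∑ᴾ-inBox {a = a} {lo e} {hi e} proper-e ⟩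
    2 ^ d ∎
    where open ≡-Reasoning

  size-pointsOf-≤ : ∀ e → size (pointsOf e) ≤ 2 ^ d
  size-pointsOf-≤ e = by-cases (proper e) refl
    where
    by-cases : ∀ b → proper e ≡ b → size (pointsOf e) ≤ 2 ^ d
    by-cases true  proper-e = ≤-reflexive (size-pointsOf e proper-e)
    by-cases false improper-e = ≤-trans (≤-reflexive (trans
      (sum-cong-≗ (λ k → cong (λ b → indicator (b ∧ inBox (lo e) (hi e) (point k))) improper-e))
      (size-∅ N))) z≤n

  boxes-through : ∀ k → ∑[ e < N * N ] indicator (pointsOf e k) ≡ volume (λ i → a i ∸ 1)
  boxes-through k = begin
    ∑[ e < N * N ] indicator (pointsOf e k)
      ≡⟨ ∑-combine N N (λ e → indicator (pointsOf e k)) ⟩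
    ∑[ x < N ] ∑[ y < N ] indicator (pointsOf (combine x y) k)
      ≡⟨ sum-cong-≗ (λ x → sum-cong-≗ (λ y → trans
           (cong (λ (x , y) → indicator (ordered (point x) (point y) ∧ inBox (point x) (point y) r))
                 (remQuot-combine {N} {N} x y))
           (ordered-inBox-volume (point x) (point y) r))) ⟩
    ∑[ x < N ] ∑[ y < N ] Φ (point x) (point y)
      ≡⟨ sum-cong-≗ (λ x → ∑-decode (Φ (point x))
           (λ q q′ q≗q′ → volume-cong (λ i → cong (φ i _) (q≗q′ i)))) ⟩
    ∑[ x < N ] ∑ᴾ (Φ (point x))
      ≡⟨ ∑-decode (λ p → ∑ᴾ (Φ p))
           (λ p p′ p≗p′ → ∑ᴾ-cong (λ q → volume-cong (λ i → cong (λ s → φ i s (q i)) (p≗p′ i)))) ⟩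
    ∑ᴾ (λ p → ∑ᴾ (Φ p))
      ≡⟨ ∑ᴾ-cong (λ p → ∑ᴾ-cong (λ q → ordered-inBox-volume p q r)) ⟨
    ∑ᴾ (λ p → ∑ᴾ (λ q → indicator (ordered p q ∧ inBox p q r)))
      ≡⟨ ∑ᴾ-boxes-through r ⟩
    volume (λ i → a i ∸ 1) ∎
    where
    open ≡-Reasoning
    r = point k
    φ : (i : Fin d) → Fin (a i) → Fin (a i) → ℕ
    φ i s t = indicator ((s <ᵇ t) ∧ ((r i == s) ∨ (r i == t)))
    Φ : Point a → Point a → ℕ
    Φ p q = volume (λ i → φ i (p i) (q i))

  neighbours : Fin (N * N) → Fin (N * N) → Bool
  neighbours e = meets (pointsOf e) ∘ pointsOf

  size-neighbours : ∀ e → size (neighbours e) ≤ 2 ^ d * volume (λ i → a i ∸ 1)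
  size-neighbours e = begin
    ∑[ e′ < N * N ] indicator (any (λ k → pointsOf e k ∧ pointsOf e′ k))
      ≤⟨ ∑-mono (λ e′ → indicator-any≤∑ (λ k → pointsOf e k ∧ pointsOf e′ k)) ⟩
    ∑[ e′ < N * N ] ∑[ k < N ] indicator (pointsOf e k ∧ pointsOf e′ k)
      ≡⟨ ∑-comm (λ e′ k → indicator (pointsOf e k ∧ pointsOf e′ k)) ⟩
    ∑[ k < N ] ∑[ e′ < N * N ] indicator (pointsOf e k ∧ pointsOf e′ k)
      ≡⟨ sum-cong-≗ (λ k → trans (sum-cong-≗ (λ e′ → indicator-∧ (pointsOf e k) (pointsOf e′ k)))
                                 (sym (*-distribˡ-sum (indicator (pointsOf e k)) (λ e′ → indicator (pointsOf e′ k))))) ⟩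
    ∑[ k < N ] (indicator (pointsOf e k) * ∑[ e′ < N * N ] indicator (pointsOf e′ k))
      ≡⟨ sum-cong-≗ (λ k → cong (indicator (pointsOf e k) *_) (boxes-through k)) ⟩
    ∑[ k < N ] (indicator (pointsOf e k) * M)
      ≡⟨ *-distribʳ-sum M (indicator ∘ pointsOf e) ⟨
    size (pointsOf e) * M
      ≤⟨ *-monoˡ-≤ M (size-pointsOf-≤ e) ⟩
    2 ^ d * M ∎
    where
    open ≤-Reasoning
    M = volume (λ i → a i ∸ 1)

  size-dependents : ∀ e → size (remove e (neighbours e)) ≤ 2 ^ d * volume (λ i → a i ∸ 1) ∸ 1
  size-dependents e = by-cases (proper e) refl
    where
    by-cases : ∀ b → proper e ≡ b → size (remove e (neighbours e)) ≤ 2 ^ d * volume (λ i → a i ∸ 1) ∸ 1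
    by-cases true proper-e
      with k , ek ← size-pos (pointsOf e) (subst (0 <_) (sym (size-pointsOf e proper-e)) (m^n>0 2 d)) =
      ≤-trans (≤-reflexive (cong (_∸ 1) (sym (size-remove (neighbours e) e-meets-itself))))
              (∸-monoˡ-≤ 1 (size-neighbours e))
      where
      e-meets-itself : neighbours e e ≡ true
      e-meets-itself = any⁺ k (trans (cong₂ _∧_ ek ek) refl)
    by-cases false improper-e = ≤-trans (size-mono isolated) (≤-trans (≤-reflexive (size-∅ (N * N))) z≤n)
      where
      isolated : remove e (neighbours e) ⊆ (λ _ → false)
      isolated e′ dep with k , shared ← any⁻ {f = λ k → pointsOf e k ∧ pointsOf e′ k} (∧-conicalˡ _ _ dep)
        with () ← trans (sym improper-e) (∧-conicalˡ _ _ (∧-conicalˡ (pointsOf e k) _ shared))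

  lowCorner highCorner : Box a → Point a
  lowCorner  B i = low  (Box.lo B i) (Box.hi B i)
  highCorner B i = high (Box.lo B i) (Box.hi B i)

  eventOf : Box a → Fin (N * N)
  eventOf B = combine (encode (lowCorner B)) (encode (highCorner B))

  lo-eventOf : ∀ B i → lo (eventOf B) i ≡ lowCorner B i
  lo-eventOf B i = trans (cong (λ (x , _) → point x i) (remQuot-combine {N} {N} (encode (lowCorner B)) _))
                         (decode-encode (lowCorner B) i)

  hi-eventOf : ∀ B i → hi (eventOf B) i ≡ highCorner B i
  hi-eventOf B i = trans (cong (λ (_ , y) → point y i) (remQuot-combine {N} {N} _ (encode (highCorner B))))
                         (decode-encode (highCorner B) i)

  proper-eventOf : ∀ B → proper (eventOf B) ≡ true
  proper-eventOf B = all⁺ (λ i → trans (cong₂ _<ᵇ_ (lo-eventOf B i) (hi-eventOf B i)) (low<ᵇhigh (Box.dist B i)))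

  pointsOf-eventOf : ∀ B k → pointsOf (eventOf B) k ≡ true →
    ∀ i → boxPoint B (λ i → point k i == Box.hi B i) i ≡ point k i
  pointsOf-eventOf B k k∈ i = begin
    boxPoint B s i                                                       ≡⟨ boxPoint-if B s i ⟩
    (if point k i == Box.hi B i then Box.hi B i else Box.lo B i)         ≡⟨ endpoint-if endpoint ⟩
    point k i                                                            ∎
    where
    open ≡-Reasoning
    s : Fin d → Bool
    s i = point k i == Box.hi B i
    t = point k i
    endpoint : ((t == Box.lo B i) ∨ (t == Box.hi B i)) ≡ true
    endpoint = begin
      (t == Box.lo B i) ∨ (t == Box.hi B i)             ≡⟨ low-high-endpoints (Box.lo B i) (Box.hi B i) t ⟨
      (t == lowCorner B i) ∨ (t == highCorner B i)
        ≡⟨ cong₂ (λ l h → (t == l) ∨ (t == h)) (lo-eventOf B i) (hi-eventOf B i) ⟨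
      (t == lo (eventOf B) i) ∨ (t == hi (eventOf B) i) ≡⟨ all⁻ (∧-conicalʳ _ _ k∈) i ⟩
      true                                              ∎

  colorable-if-avoidable : ∀ {c} (σ : Point {N} (λ _ → c)) →
    (∀ e → proper e ∧ monochromatic (pointsOf e) σ ≡ false) → Colorable c a
  colorable-if-avoidable {c} σ avoided guaranteed
    with B , k , B-mono ← guaranteed (σ ∘ encode) =
    contradiction (trans (sym (avoided (eventOf B))) (cong₂ _∧_ (proper-eventOf B) eventOf-mono)) λ ()
    where
    eventOf-mono : monochromatic (pointsOf (eventOf B)) σ ≡ true
    eventOf-mono = any⁺ k (all⁺ pointwise)
      where
      pointwise : ∀ j → not (pointsOf (eventOf B) j) ∨ (σ j == k) ≡ true
      pointwise j with pointsOf (eventOf B) j in j∈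
      ... | false = refl
      ... | true  = trans (cong (_== k) σj≡k) (dec-true (k ≟ k) refl)
        where
        σj≡k : σ j ≡ k
        σj≡k = begin
          σ j                                         ≡⟨ cong σ (encode-decode {a = a} j) ⟨
          σ (encode (point j))                        ≡⟨ cong σ (encode-cong (pointsOf-eventOf B j j∈)) ⟨
          σ (encode (boxPoint B (λ i → point j i == Box.hi B i))) ≡⟨ B-mono (λ i → point j i == Box.hi B i) ⟩
          k                                           ∎
          where open ≡-Reasoning

  count-monochromatic-box : ∀ c .{{_ : NonZero c}} e →
    count (λ σ → proper e ∧ monochromatic {c} (pointsOf e) σ) * c ^ (2 ^ d ∸ 1) ≤ c ^ N
  count-monochromatic-box c e = by-cases (proper e) refl
    where
    mono = monochromatic {c} (pointsOf e)
    by-cases : ∀ b → proper e ≡ b → count (λ σ → b ∧ mono σ) * c ^ (2 ^ d ∸ 1) ≤ c ^ N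
    by-cases false _ = ≤-trans (≤-reflexive (cong (_* c ^ (2 ^ d ∸ 1)) (count-const-∧ false mono))) z≤n
    by-cases true  proper-e = *-cancelˡ-≤ c (begin
      c * (count mono * c ^ (2 ^ d ∸ 1))
        ≡⟨ x∙yz≈y∙xz c (count mono) (c ^ (2 ^ d ∸ 1)) ⟩
      count mono * c ^ suc (2 ^ d ∸ 1)
        ≡⟨ cong (λ k → count mono * c ^ k) (trans (suc-pred (2 ^ d) {{m^n≢0 2 d}}) (sym (size-pointsOf e proper-e))) ⟩
      count mono * c ^ size (pointsOf e)
        ≤⟨ count-monochromatic (pointsOf e) ⟩
      c * c ^ N ∎)
      where open ≤-Reasoning

-- Partial sums of the exponential series

-- expSum D n i = Σ_{k ≤ n} (n! / k!) D^(n-k) i^k, so that expSum D n D = D^n · eNum n, while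
-- its growth in i is controlled by (i + 1)^k ≥ i^k + k i^(k-1).
expSum : ℕ → ℕ → ℕ → ℕ
expSum D zero    i = 1
expSum D (suc n) i = suc n * D * expSum D n i + i ^ suc n

^-suc-bernoulli : ∀ i m → i ^ suc m + suc m * i ^ m ≤ suc i ^ suc m
^-suc-bernoulli i zero = ≤-reflexive (+-comm (i * 1) 1)
^-suc-bernoulli i (suc m) = begin
  i ^ suc (suc m) + suc (suc m) * i ^ suc m
    ≤⟨ m≤m+n _ (suc m * i ^ m) ⟩
  i ^ suc (suc m) + suc (suc m) * i ^ suc m + suc m * i ^ m
    ≡⟨ regroup i m (i ^ m) ⟩
  suc i * (i ^ suc m + suc m * i ^ m)
    ≤⟨ *-monoʳ-≤ (suc i) (^-suc-bernoulli i m) ⟩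
  suc i * suc i ^ suc m ∎
  where
  open ≤-Reasoning
  regroup : ∀ i m x → i * (i * x) + suc (suc m) * (i * x) + suc m * x ≡ suc i * (i * x + suc m * x)
  regroup = solve-∀

expSum-shift : ∀ D n i → expSum D (suc n) i + suc n * expSum D n i ≤ expSum D (suc n) (suc i)
expSum-shift D zero i = begin
  1 * D * 1 + i ^ 1 + 1 * 1   ≡⟨ +-assoc (1 * D * 1) (i ^ 1) (1 * 1) ⟩
  1 * D * 1 + (i ^ 1 + 1 * 1) ≤⟨ +-monoʳ-≤ (1 * D * 1) (^-suc-bernoulli i 0) ⟩
  1 * D * 1 + suc i ^ 1       ∎
  where open ≤-Reasoning
expSum-shift D (suc n) i = begin
  expSum D (suc (suc n)) i + suc (suc n) * expSum D (suc n) i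
    ≡⟨ regroup (suc n) D (expSum D (suc n) i) (expSum D n i) (i ^ suc (suc n)) (i ^ suc n) ⟩
  suc (suc n) * D * (expSum D (suc n) i + suc n * expSum D n i) + (i ^ suc (suc n) + suc (suc n) * i ^ suc n)
    ≤⟨ +-mono-≤ (*-monoʳ-≤ (suc (suc n) * D) (expSum-shift D n i)) (^-suc-bernoulli i (suc n)) ⟩
  expSum D (suc (suc n)) (suc i) ∎
  where
  open ≤-Reasoning
  regroup : ∀ n D g h p q → suc n * D * g + p + suc n * (n * D * h + q)
                          ≡ suc n * D * (g + n * h) + (p + suc n * q)
  regroup = solve-∀

expSum-step : ∀ D n i → suc n * suc D * expSum D n i ≤ expSum D (suc n) (suc i)
expSum-step D n i = begin
  suc n * suc D * expSum D n i
    ≡⟨ split (suc n) D (expSum D n i) ⟩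
  suc n * D * expSum D n i + suc n * expSum D n i
    ≤⟨ +-monoˡ-≤ (suc n * expSum D n i) (m≤m+n (suc n * D * expSum D n i) (i ^ suc n)) ⟩
  expSum D (suc n) i + suc n * expSum D n i
    ≤⟨ expSum-shift D n i ⟩
  expSum D (suc n) (suc i) ∎
  where
  open ≤-Reasoning
  split : ∀ n D g → n * suc D * g ≡ n * D * g + n * g
  split = solve-∀

suc^n*n!≤expSum : ∀ D n → suc D ^ n * fact n ≤ expSum D n n
suc^n*n!≤expSum D zero = ≤-refl
suc^n*n!≤expSum D (suc n) = begin
  suc D ^ suc n * fact (suc n)     ≡⟨ regroup (suc D) (suc D ^ n) n (fact n) ⟩
  suc n * suc D * (suc D ^ n * fact n) ≤⟨ *-monoʳ-≤ (suc n * suc D) (suc^n*n!≤expSum D n) ⟩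
  suc n * suc D * expSum D n n     ≤⟨ expSum-step D n n ⟩
  expSum D (suc n) (suc n)         ∎
  where
  open ≤-Reasoning
  regroup : ∀ a p n f → a * p * (suc n * f) ≡ suc n * a * (p * f)
  regroup = solve-∀

expSum-at-D : ∀ D n → expSum D n D ≡ D ^ n * eNum n
expSum-at-D D zero = refl
expSum-at-D D (suc n) rewrite expSum-at-D D n = regroup D n (D ^ n) (eNum n)
  where
  regroup : ∀ D n p e → suc n * D * (p * e) + D * p ≡ D * p * (suc n * e + 1)
  regroup = solve-∀

suc^D*D!≤D^D*eNum : ∀ D → suc D ^ D * fact D ≤ D ^ D * eNum D
suc^D*D!≤D^D*eNum D = ≤-trans (suc^n*n!≤expSum D D) (≤-reflexive (expSum-at-D D D))

fact-nonZero : ∀ n → NonZero (fact n)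
fact-nonZero zero    = _
fact-nonZero (suc n) = m*n≢0 (suc n) (fact n) {{_}} {{fact-nonZero n}}

*-^-<⇒*-fact<eNum : ∀ D x → x * D ^ D < suc D ^ suc D → x * fact D < suc D * eNum D
*-^-<⇒*-fact<eNum D x lt = *-cancelˡ-< (D ^ D) _ _ (begin-strict
  D ^ D * (x * fact D)           ≡⟨ x∙yz≈yx∙z (D ^ D) x (fact D) ⟩
  x * D ^ D * fact D             <⟨ *-monoˡ-< (fact D) {{fact-nonZero D}} lt ⟩
  suc D * suc D ^ D * fact D     ≡⟨ *-assoc (suc D) (suc D ^ D) (fact D) ⟩
  suc D * (suc D ^ D * fact D)   ≤⟨ *-monoʳ-≤ (suc D) (suc^D*D!≤D^D*eNum D) ⟩
  suc D * (D ^ D * eNum D)       ≡⟨ x∙yz≈y∙xz (suc D) (D ^ D) (eNum D) ⟩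
  D ^ D * (suc D * eNum D)       ∎)
  where open ≤-Reasoning

-- Colourability of small grids

volume-pred< : ∀ {d} (a : Fin (suc d) → ℕ) → Positive a → volume (λ i → a i ∸ 1) < volume a
volume-pred< a pos = begin-strict
  (a zero ∸ 1) * volume (λ i → a (suc i) ∸ 1) ≤⟨ *-monoʳ-≤ (a zero ∸ 1) (volume-mono (λ i → m∸n≤m (a (suc i)) 1)) ⟩
  (a zero ∸ 1) * volume (a ∘ suc)             <⟨ *-monoˡ-< (volume (a ∘ suc)) (pred< (pos zero)) ⟩
  a zero * volume (a ∘ suc)                   ∎
  where
  open ≤-Reasoning
  instance
    _ : NonZero (volume (a ∘ suc))
    _ = >-nonZero (volume-pos (a ∘ suc) (pos ∘ suc))
  pred< : ∀ {n} → 1 ≤ n → n ∸ 1 < n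
  pred< (s≤s _) = ≤-refl

grids-colorable : ∀ c d V → 1 ≤ c → 1 ≤ d → 1 ≤ V →
  let D = 2 ^ d * V ∸ 1 in suc D ^ suc D ≤ c ^ (2 ^ d ∸ 1) * D ^ D →
  AllColorableUpTo c d (suc V)
grids-colorable c d@(suc d′) V 1≤c _ 1≤V condition a pos vol≤ =
  let σ , avoided = LovászLocalLemma.avoidable D bad pointsOf determined rare sparse 1≤D
                      (volume-pos {N} (λ _ → c) (λ _ → 1≤c))
  in colorable-if-avoidable σ avoided
  where
  open BoxEvents a
  instance
    c≢0 : NonZero c
    c≢0 = >-nonZero 1≤c
  D = 2 ^ d * V ∸ 1
  bad : Fin (N * N) → Point {N} (λ _ → c) → _
  bad e σ = proper e ∧ monochromatic (pointsOf e) σ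
  determined : ∀ e → DeterminedBy (pointsOf e) (bad e)
  determined e σ τ σ≗τ = cong (proper e ∧_) (monochromatic-determined (pointsOf e) σ τ σ≗τ)
  rare : ∀ e → count (bad e) * suc D ^ suc D ≤ volume {N} (λ _ → c) * D ^ D
  rare e = begin
    count (bad e) * suc D ^ suc D               ≤⟨ *-monoʳ-≤ (count (bad e)) condition ⟩
    count (bad e) * (c ^ (2 ^ d ∸ 1) * D ^ D)   ≡⟨ *-assoc (count (bad e)) _ _ ⟨
    count (bad e) * c ^ (2 ^ d ∸ 1) * D ^ D     ≤⟨ *-monoˡ-≤ (D ^ D) (count-monochromatic-box c e) ⟩
    c ^ N * D ^ D                               ≡⟨ cong (_* D ^ D) (volume-const N c) ⟨
    volume {N} (λ _ → c) * D ^ D                ∎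
    where open ≤-Reasoning
  sparse : ∀ e → size (remove e (neighbours e)) ≤ D
  sparse e = ≤-trans (size-dependents e)
    (∸-monoˡ-≤ 1 (*-monoʳ-≤ (2 ^ d) (≤-pred (<-≤-trans (volume-pred< a pos) vol≤))))
  1≤D : 1 ≤ D
  1≤D = ∸-monoˡ-≤ 1 (*-mono-≤ (*-monoʳ-≤ 2 (m^n>0 2 d′)) 1≤V)

Fin≤1-irrelevant : ∀ {n} → n ≤ 1 → (x y : Fin n) → x ≡ y
Fin≤1-irrelevant (s≤s z≤n) zero zero = refl

unit-grids-colorable : ∀ c d → 1 ≤ c → 1 ≤ d → AllColorableUpTo c d 1
unit-grids-colorable (suc c) (suc d) _ _ a pos vol≤1 guaranteed =
  Box.dist B zero (Fin≤1-irrelevant first-side≤1 _ _)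
  where
  B = proj₁ (guaranteed (λ _ → zero))
  first-side≤1 : a zero ≤ 1
  first-side≤1 = ≤-trans (m≤m*n (a zero) (volume (a ∘ suc)) {{>-nonZero (volume-pos (a ∘ suc) (pos ∘ suc))}})
                         vol≤1

mainTheorem1 : (c d : ℕ) → 1 ≤ c → 1 ≤ d → (V : ℕ) → IsV c d V →
    ∃ λ n → (c ^ (2 ^ d ∸ 1)) * fact n < (2 ^ d) * V * eNum n
mainTheorem1 c d 1≤c 1≤d zero (_ , maximal) =
  contradiction (maximal 1 (unit-grids-colorable c d 1≤c 1≤d)) λ ()
mainTheorem1 c d 1≤c 1≤d V@(suc _) (_ , maximal) = by-condition (suc D ^ suc D ≤? c ^ (2 ^ d ∸ 1) * D ^ D)
  where
  D = 2 ^ d * V ∸ 1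
  by-condition : Dec (suc D ^ suc D ≤ c ^ (2 ^ d ∸ 1) * D ^ D) →
    ∃ λ n → c ^ (2 ^ d ∸ 1) * fact n < 2 ^ d * V * eNum n
  by-condition (yes condition) = contradiction (maximal (suc V) (grids-colorable c d V 1≤c 1≤d z<s condition)) 1+n≰n
  by-condition (no ¬condition) = D , subst (λ x → c ^ (2 ^ d ∸ 1) * fact D < x * eNum D)
    (suc-pred (2 ^ d * V) {{m*n≢0 (2 ^ d) V {{m^n≢0 2 d}}}})
    (*-^-<⇒*-fact<eNum D (c ^ (2 ^ d ∸ 1)) (≰⇒> ¬condition))
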